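{- Let $\ell\ge 1$, let $\mathcal{T}$ be an $\ell$-index-tree, and let $i,b\in\{1,\dots,\ell\}$ with $i<b$. Then either $i$ lies in $\mathcal{T}(b^-)$, or $i$ lies in $\mathcal{T}(k^+)$ for some ancestor $k$ of $b$ (possibly $k=b$).
   Context: A partial binary tree is a rooted tree in which every node has at most one left child and at most one right child (left and right being distinguished). An $\ell$-index-tree is a partial binary tree whose vertices (called indices) are the integers $1,\dots,\ell$, labelled as follows: perform a depth-first preorder traversal from the root, always visiting the left child of a node before its right child; the $k$-th visited node receives label $\ell+1-k$. (Thus the root is $\ell$, every index is larger than its descendants, and for every index, all indices in its left subtree are larger than all indices in its right subtree.) For an index $i$, $i^-$ and $i^+$ denote its left and right child, $\mathcal{T}(i)$ denotes the subtree rooted at $i$, and $\mathcal{T}(i^-)$, $\mathcal{T}(i^+)$ the subtrees rooted at $i^-$, $i^+$ (empty if the child does not exist). A node $s$ is an ancestor of $t$ if $s$ lies on the path from $t$ to the root (including $s=t$). -}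

module Defs where

open import Data.Nat using (ℕ; zero; suc; _+_; _∸_)
open import Data.List using (List; []; _∷_; _++_)
open import Data.Product using (Σ; ∃; _×_; _,_)

-- Shape of a (nonempty-or-empty) partial binary tree: every node has at most
-- one left child and at most one right child (`leaf` = absent child).
data Tree : Set where
  leaf : Tree
  node : (left right : Tree) → Tree

size : Tree → ℕ
size leaf       = 0
size (node l r) = suc (size l + size r)

data Dir : Set where
  L R : Dir

Path : Set
Path = List Dir

-- Preorder labelling (left before right).  `Label t n p m` : in the tree t
-- whose nodes receive, in DFS-preorder order, the labels n, n-1, n-2, ...,
-- the node at position p exists and receives label m.  (The k-th visited
-- node gets label n+1-k: the root gets n, the left subtree is visited next
-- starting with n-1, then the right subtree starting with n-1-|left|.)
data Label : Tree → ℕ → Path → ℕ → Set where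
  here : ∀ {l r n} → Label (node l r) n [] n
  goL  : ∀ {l r n p m} → Label l (n ∸ 1) p m → Label (node l r) n (L ∷ p) m
  goR  : ∀ {l r n p m} → Label r (n ∸ 1 ∸ size l) p m → Label (node l r) n (R ∷ p) m

-- The ℓ-index-tree on T (ℓ = size T): position p carries index m.
Index : Tree → Path → ℕ → Set
Index T p m = Label T (size T) p m

InLeftSubtree : Tree → (b i : ℕ) → Set
InLeftSubtree T b i = Σ Path λ pb → Σ Path λ q → Index T pb b × Index T (pb ++ (L ∷ q)) i

InRightSubtree : Tree → (k i : ℕ) → Set
InRightSubtree T k i = Σ Path λ pk → Σ Path λ q → Index T pk k × Index T (pk ++ (R ∷ q)) i

Ancestor : Tree → (k b : ℕ) → Set
Ancestor T k b = Σ Path λ pk → Σ Path λ q → Index T pk k × Index T (pk ++ q) b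

{-# OPTIONS --safe #-}
-- If a subtree t gets the labels (c, c + size t], then a node l r puts its largest
-- label at the root, the interval (c + size r, c + size r + size l] on its left subtree
-- and (c, c + size r] on its right subtree.  Walk down towards b while i lies in the
-- same child subtree.  At the node k where the walk stops, k is an ancestor of b and
-- either k = b, so i < b lies in 𝒯(b⁻) or in 𝒯(b⁺), or b lies in 𝒯(k⁻) and i in 𝒯(k⁺);
-- the converse split is impossible because left labels exceed right labels.
module Submission where

open import Defs
open import Data.Nat using (ℕ; _≤_; _<_; suc; _+_; _∸_; _≤?_)
open import Data.Nat.Properties
  using (+-suc; +-identityʳ; +-comm; +-assoc; m+n∸n≡m; ≤-antisym; ≤-trans; <-trans; <⇒≤; ≰⇒>; <⇒≱)
open import Data.Sum using (_⊎_; inj₁; inj₂)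
open import Data.Product using (Σ; ∃-syntax; _×_; _,_)
import Data.Product as Product
open import Data.List using ([]; _∷_; _++_)
open import Data.Empty using (⊥-elim)
open import Relation.Binary.PropositionalEquality using (_≡_; refl; sym; cong; subst; module ≡-Reasoning)
open import Relation.Nullary using (yes; no)

LeftOrAncestorRight : (Path → ℕ → Set) → (b i : ℕ) → Set
LeftOrAncestorRight lab b i =
  (Σ Path λ pb → Σ Path λ q → lab pb b × lab (pb ++ (L ∷ q)) i) ⊎
  (∃[ k ] ((Σ Path λ pk → Σ Path λ q → lab pk k × lab (pk ++ q) b) ×
           (Σ Path λ pk → Σ Path λ q → lab pk k × lab (pk ++ (R ∷ q)) i)))

LeftOrAncestorRight-lift : ∀ {lab lab′ : Path → ℕ → Set} {b i} (d : Dir) →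
  (∀ {p m} → lab p m → lab′ (d ∷ p) m) →
  LeftOrAncestorRight lab b i → LeftOrAncestorRight lab′ b i
LeftOrAncestorRight-lift d f (inj₁ (pb , q , b-at , i-at)) = inj₁ (d ∷ pb , q , f b-at , f i-at)
LeftOrAncestorRight-lift d f (inj₂ (k , (pk , q , k-at , b-at) , (pk′ , q′ , k-at′ , i-at))) =
  inj₂ (k , (d ∷ pk , q , f k-at , f b-at) , (d ∷ pk′ , q′ , f k-at′ , f i-at))

module _ {l r : Tree} {c : ℕ} where

  top-node : c + size (node l r) ≡ suc (c + size r + size l)
  top-node = begin
    c + suc (size l + size r)  ≡⟨ +-suc c _ ⟩
    suc (c + (size l + size r)) ≡⟨ cong (λ s → suc (c + s)) (+-comm (size l) (size r)) ⟩
    suc (c + (size r + size l)) ≡⟨ cong suc (sym (+-assoc c (size r) (size l))) ⟩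
    suc (c + size r + size l)   ∎
    where open ≡-Reasoning

  here-node : ∀ {m} → m ≡ c + size (node l r) → Label (node l r) (c + size (node l r)) [] m
  here-node refl = here

  goL-node : ∀ {p m} → Label l (c + size r + size l) p m →
             Label (node l r) (c + size (node l r)) (L ∷ p) m
  goL-node {p} {m} lab = goL (subst (λ n → Label l n p m) (sym (cong (_∸ 1) top-node)) lab)

  goR-node : ∀ {p m} → Label r (c + size r) p m →
             Label (node l r) (c + size (node l r)) (R ∷ p) m
  goR-node {p} {m} lab = goR (subst (λ n → Label r n p m) (sym top-right) lab)
    where
    top-right : c + size (node l r) ∸ 1 ∸ size l ≡ c + size r
    top-right = begin
      c + size (node l r) ∸ 1 ∸ size l ≡⟨ cong (λ n → n ∸ 1 ∸ size l) top-node ⟩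
      c + size r + size l ∸ size l     ≡⟨ m+n∸n≡m (c + size r) (size l) ⟩
      c + size r                       ∎
      where open ≡-Reasoning

  data Region (m : ℕ) : Set where
    root  : m ≡ c + size (node l r) → Region m
    left  : c + size r < m → m ≤ c + size r + size l → Region m
    right : c < m → m ≤ c + size r → Region m

  region : ∀ {m} → c < m → m ≤ c + size (node l r) → Region m
  region {m} c<m m≤top with m ≤? c + size r + size l
  ... | no m≰ = root (≤-antisym m≤top (subst (_≤ m) (sym top-node) (≰⇒> m≰)))
  ... | yes m≤ with m ≤? c + size r
  ...   | no m≰  = left (≰⇒> m≰) m≤
  ...   | yes m≤′ = right c<m m≤′

label-exists : ∀ t c {m} → c < m → m ≤ c + size t → Σ Path λ p → Label t (c + size t) p m
label-exists leaf c c<m m≤c+0 = ⊥-elim (<⇒≱ c<m (subst (_ ≤_) (+-identityʳ c) m≤c+0))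
label-exists (node l r) c c<m m≤top with region c<m m≤top
... | root m≡top  = [] , here-node m≡top
... | left lo hi  = Product.map (L ∷_) goL-node (label-exists l (c + size r) lo hi)
... | right lo hi = Product.map (R ∷_) goR-node (label-exists r c lo hi)

left-or-ancestor-right : ∀ t c {i b} → c < i → i < b → b ≤ c + size t →
  LeftOrAncestorRight (Label t (c + size t)) b i
left-or-ancestor-right leaf c c<i i<b b≤c+0 =
  ⊥-elim (<⇒≱ (<-trans c<i i<b) (subst (_ ≤_) (+-identityʳ c) b≤c+0))
left-or-ancestor-right (node l r) c c<i i<b b≤top
  with region (<-trans c<i i<b) b≤top | region c<i (≤-trans (<⇒≤ i<b) b≤top)
... | _ | root i≡top = ⊥-elim (<⇒≱ i<b (subst (_ ≤_) (sym i≡top) b≤top))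
... | root b≡top | left i-lo i-hi =
  let p , i-at = label-exists l (c + size r) i-lo i-hi
  in  inj₁ ([] , p , here-node b≡top , goL-node i-at)
... | root b≡top | right i-lo i-hi =
  let p , i-at = label-exists r c i-lo i-hi
  in  inj₂ (_ , ([] , [] , here-node b≡top , here-node b≡top) , ([] , p , here-node b≡top , goR-node i-at))
... | left _ b-hi | left i-lo _ =
  LeftOrAncestorRight-lift L goL-node (left-or-ancestor-right l (c + size r) i-lo i<b b-hi)
... | left b-lo b-hi | right i-lo i-hi =
  let pb , b-at = label-exists l (c + size r) b-lo b-hi
      p  , i-at = label-exists r c i-lo i-hi
  in  inj₂ (_ , ([] , L ∷ pb , here , goL-node b-at) , ([] , p , here , goR-node i-at))
... | right _ b-hi | left i-lo _ = ⊥-elim (<⇒≱ (<-trans i-lo i<b) b-hi)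
... | right _ b-hi | right _ _ =
  LeftOrAncestorRight-lift R goR-node (left-or-ancestor-right r c c<i i<b b-hi)

proposition3p7 : (ℓ : ℕ) → 1 ≤ ℓ → (T : Tree) → size T ≡ ℓ →
    (i b : ℕ) → 1 ≤ i → i ≤ ℓ → 1 ≤ b → b ≤ ℓ → i < b →
    InLeftSubtree T b i ⊎ (∃[ k ] (Ancestor T k b × InRightSubtree T k i))
proposition3p7 .(size T) _ T refl i b 1≤i _ _ b≤ℓ i<b = left-or-ancestor-right T 0 1≤i i<b b≤ℓ
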